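{- Let $\mathcal{M}$ be a matroid with $\mathsf{rank}(\mathcal{M})\ge 1$ and let $k\ge 0$ be an integer. Then every $k$-fault-tolerant basis $B$ of $\mathcal{M}$ satisfies $\mathsf{rank}(\mathcal{M})+k\le |B|\le (k+1)\,\mathsf{rank}(\mathcal{M})$.
   Context: For a matroid $\mathcal{M}=(E,\mathcal{I})$ with rank function $\mathsf{rank}$ and a nonnegative integer $k$, a set $B\subseteq E$ is a $k$-fault-tolerant basis of $\mathcal{M}$ if $B$ is a set of minimum cardinality among all sets $B\subseteq E$ with the property that $\mathsf{rank}(B\setminus F)=\mathsf{rank}(\mathcal{M})$ for every $F\subseteq B$ with $|F|\le k$. -}

module Defs where

open import Level using (Level; suc; _⊔_)
open import Data.Nat using (ℕ; _≤_)
open import Data.Product using (Σ; _×_; ∃)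
open import Relation.Binary.PropositionalEquality using (_≡_)
open import Data.Fin.Subset using (Subset; _⊆_; ∣_∣; ⊥; ⊤; _─_)

record Matroid (n : ℕ) : Set₁ where
  field
    Indep      : Subset n → Set
    indep-∅    : Indep ⊥
    indep-⊆    : ∀ {I J} → J ⊆ I → Indep I → Indep J
    indep-aug  : ∀ {I J} → Indep I → Indep J → ∣ I ∣ Data.Nat.< ∣ J ∣ →
                 ∃ λ x → (x Data.Fin.Subset.∈ J) × (x Data.Fin.Subset.∉ I)
                        × Indep (I Data.Fin.Subset.∪ Data.Fin.Subset.⁅ x ⁆)

module _ {n : ℕ} (M : Matroid n) where
  open Matroid M

  IsRank : Subset n → ℕ → Set
  IsRank A r = (Σ (Subset n) λ I → I ⊆ A × Indep I × ∣ I ∣ ≡ r)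
             × (∀ I → I ⊆ A → Indep I → ∣ I ∣ ≤ r)

  IsMatroidRank : ℕ → Set
  IsMatroidRank r = IsRank ⊤ r

  FaultTolerant : ℕ → Subset n → Set
  FaultTolerant k B = ∀ F → F ⊆ B → ∣ F ∣ ≤ k →
                      ∀ r → IsMatroidRank r → IsRank (B ─ F) r

  IsFTBasis : ℕ → Subset n → Set
  IsFTBasis k B = FaultTolerant k B
                × (∀ B′ → FaultTolerant k B′ → ∣ B ∣ ≤ ∣ B′ ∣)

-- Lower bound: deleting any k elements of B leaves a set of rank r, hence of at least r elements;
-- if k ≥ ∣ B ∣ all of B could be deleted, leaving rank 0 < r.
-- Upper bound: let G = I₀ ∪ … ∪ Iₖ, where each layer Iⱼ is a maximal independent subset of what
-- B has left after removing the earlier layers, so ∣ G ∣ ≤ (k + 1) r. An element e ∈ B outside G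
-- is spanned by every layer, and a deletion of at most k elements misses one of the k + 1
-- disjoint layers; so B - e is still k-fault-tolerant, contradicting the minimality of B.
-- Hence B ⊆ G.

module Submission where

open import Defs
open import Data.Nat using (ℕ; zero; suc; _≤_; _<_; _+_; _*_; z≤n; s≤s; _≤?_)
open import Data.Nat.Properties
  using ( ≤-trans; ≤-reflexive; ≤-antisym; ≤-pred; <⇒≤; <⇒≱; ≮⇒≥; ≰⇒>; n≤1+n; m≤m+n
        ; +-suc; +-mono-≤; +-monoˡ-≤; +-monoʳ-≤; module ≤-Reasoning )
open import Data.Bool using (true; false)
open import Data.Vec using ([]; _∷_; here; there)
open import Data.Fin using (Fin; _≟_)
open import Data.Fin.Properties using (any?)
open import Data.Fin.Subset
open import Data.Fin.Subset.Properties
open import Data.Product using (_×_; _,_; proj₁; ∃-syntax)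
open import Data.Sum using (_⊎_; inj₁; inj₂)
open import Function using (_∘_)
open import Relation.Nullary using (¬_; Dec; yes; no; contradiction)
open import Relation.Nullary.Decidable using (_×-dec_; ¬?; decidable-stable; ¬¬-excluded-middle)
open import Relation.Binary.PropositionalEquality using (_≡_; refl; sym; trans; cong; subst)

private variable n : ℕ

x∈p─q⇒x∉q : {x : Fin n} {p q : Subset n} → x ∈ p ─ q → x ∉ q
x∈p─q⇒x∉q {p = true ∷ p} {q = false ∷ q} here ()
x∈p─q⇒x∉q {p = _ ∷ p} {q = _ ∷ q} (there x∈p─q) (there x∈q) = x∈p─q⇒x∉q x∈p─q x∈q

∪-lub : {p q r : Subset n} → p ⊆ r → q ⊆ r → p ∪ q ⊆ r
∪-lub {p = p} {q = q} p⊆r q⊆r x∈p∪q with x∈p∪q⁻ p q x∈p∪q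
... | inj₁ x∈p = p⊆r x∈p
... | inj₂ x∈q = q⊆r x∈q

∪-monoˡ-⊆ : {p q : Subset n} (r : Subset n) → p ⊆ q → p ∪ r ⊆ q ∪ r
∪-monoˡ-⊆ {q = q} r p⊆q = ∪-lub (⊆-trans p⊆q (p⊆p∪q r)) (q⊆p∪q q r)

∣p∣<∣p∪⁅x⁆∣ : {x : Fin n} {p : Subset n} → x ∉ p → ∣ p ∣ < ∣ p ∪ ⁅ x ⁆ ∣
∣p∣<∣p∪⁅x⁆∣ {x = x} x∉p = p⊂q⇒∣p∣<∣q∣ (p⊆p∪q ⁅ x ⁆ , x , x∈p∪q⁺ (inj₂ (x∈⁅x⁆ x)) , x∉p)

x∈p⇒⁅x⁆⊆p : {x : Fin n} {p : Subset n} → x ∈ p → ⁅ x ⁆ ⊆ p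
x∈p⇒⁅x⁆⊆p {x = x} {p} x∈p y∈⁅x⁆ = subst (_∈ p) (sym (x∈⁅y⁆⇒x≡y x y∈⁅x⁆)) x∈p

p─q─[r-x]⊆p─r : {x : Fin n} {p q r : Subset n} → x ∈ q → p ─ q ─ (r - x) ⊆ p ─ r
p─q─[r-x]⊆p─r {x = x} {p} {q} {r} x∈q {y} y∈lhs = x∈p∧x∉q⇒x∈p─q (p─q⊆p p q y∈p─q) y∉r
  where
  y∈p─q : y ∈ p ─ q
  y∈p─q = p─q⊆p (p ─ q) (r - x) y∈lhs
  y∉r : y ∉ r
  y∉r y∈r = x∈p─q⇒x∉q y∈lhs (x∈p∧x≢y⇒x∈p-y y∈r λ { refl → x∈p─q⇒x∉q y∈p─q x∈q })

⊆⊎∃∉ : (p q : Subset n) → p ⊆ q ⊎ ∃[ x ] x ∈ p × x ∉ q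
⊆⊎∃∉ p q with any? (λ x → x ∈? p ×-dec ¬? (x ∈? q))
... | yes (x , x∈p , x∉q) = inj₂ (x , x∈p , x∉q)
... | no ∄x = inj₁ λ {x} x∈p → decidable-stable (x ∈? q) λ x∉q → ∄x (x , x∈p , x∉q)

∣p∪q∣≤∣p∣+∣q∣ : (p q : Subset n) → ∣ p ∪ q ∣ ≤ ∣ p ∣ + ∣ q ∣
∣p∪q∣≤∣p∣+∣q∣ []          []          = z≤n
∣p∪q∣≤∣p∣+∣q∣ (false ∷ p) (false ∷ q) = ∣p∪q∣≤∣p∣+∣q∣ p q
∣p∪q∣≤∣p∣+∣q∣ (false ∷ p) (true ∷ q)  =
  subst (suc ∣ p ∪ q ∣ ≤_) (sym (+-suc ∣ p ∣ ∣ q ∣)) (s≤s (∣p∪q∣≤∣p∣+∣q∣ p q))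
∣p∪q∣≤∣p∣+∣q∣ (true ∷ p)  (false ∷ q) = s≤s (∣p∪q∣≤∣p∣+∣q∣ p q)
∣p∪q∣≤∣p∣+∣q∣ (true ∷ p)  (true ∷ q)  =
  s≤s (≤-trans (∣p∪q∣≤∣p∣+∣q∣ p q) (+-monoʳ-≤ ∣ p ∣ (n≤1+n ∣ q ∣)))

∣p─q∣+∣q∣≡∣p∣ : (p q : Subset n) → q ⊆ p → ∣ p ─ q ∣ + ∣ q ∣ ≡ ∣ p ∣
∣p─q∣+∣q∣≡∣p∣ []          []          _   = refl
∣p─q∣+∣q∣≡∣p∣ (false ∷ p) (false ∷ q) q⊆p = ∣p─q∣+∣q∣≡∣p∣ p q (drop-∷-⊆ q⊆p)
∣p─q∣+∣q∣≡∣p∣ (true ∷ p)  (false ∷ q) q⊆p = cong suc (∣p─q∣+∣q∣≡∣p∣ p q (drop-∷-⊆ q⊆p))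
∣p─q∣+∣q∣≡∣p∣ (false ∷ p) (true ∷ q)  q⊆p with () ← q⊆p here
∣p─q∣+∣q∣≡∣p∣ (true ∷ p)  (true ∷ q)  q⊆p =
  trans (+-suc ∣ p ─ q ∣ ∣ q ∣) (cong suc (∣p─q∣+∣q∣≡∣p∣ p q (drop-∷-⊆ q⊆p)))

⊆-ofSize : (p : Subset n) (m : ℕ) → m ≤ ∣ p ∣ → ∃[ q ] q ⊆ p × ∣ q ∣ ≡ m
⊆-ofSize []          zero    _ = [] , ⊆-refl , refl
⊆-ofSize (false ∷ p) m       m≤∣p∣
  with q , q⊆p , ∣q∣≡m ← ⊆-ofSize p m m≤∣p∣ = false ∷ q , out⊆ q⊆p , ∣q∣≡m
⊆-ofSize {suc n} (true ∷ p) zero _ = ⊥ , ⊥⊆ , ∣⊥∣≡0 (suc n)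
⊆-ofSize (true ∷ p)  (suc m) (s≤s m≤∣p∣)
  with q , q⊆p , ∣q∣≡m ← ⊆-ofSize p m m≤∣p∣ = true ∷ q , in⊆in q⊆p , cong suc ∣q∣≡m

¬¬-decidable : (P : Subset n → Set) → ¬ ¬ (∀ S → Dec (P S))
¬¬-decidable {zero}  P ¬dec = ¬¬-excluded-middle λ P[]? → ¬dec λ { [] → P[]? }
¬¬-decidable {suc n} P ¬dec =
  ¬¬-decidable (λ S → P (true ∷ S)) λ P-in? →
  ¬¬-decidable (λ S → P (false ∷ S)) λ P-out? →
  ¬dec λ { (true ∷ S) → P-in? S ; (false ∷ S) → P-out? S }

module _ {n : ℕ} (M : Matroid n) where
  open Matroid M

  Maximal : Subset n → Subset n → Set
  Maximal X K = ∀ {x} → x ∈ X → x ∉ K → ¬ Indep (K ∪ ⁅ x ⁆)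

  dependent-∪⁅⁆-mono : ∀ {K K′ e} → K ⊆ K′ → ¬ Indep (K ∪ ⁅ e ⁆) → ¬ Indep (K′ ∪ ⁅ e ⁆)
  dependent-∪⁅⁆-mono {e = e} K⊆K′ dep iK′e = dep (indep-⊆ (∪-monoˡ-⊆ ⁅ e ⁆ K⊆K′) iK′e)

  dependent⇒∉ : ∀ {K e} → Indep K → ¬ Indep (K ∪ ⁅ e ⁆) → e ∉ K
  dependent⇒∉ iK dep e∈K = dep (indep-⊆ (∪-lub ⊆-refl (x∈p⇒⁅x⁆⊆p e∈K)) iK)

  maximal-insertSpanned : ∀ {X K e} → Maximal (X - e) K → ¬ Indep (K ∪ ⁅ e ⁆) → Maximal X K
  maximal-insertSpanned {e = e} max dep {x} x∈X x∉K with x ≟ e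
  ... | yes refl = dep
  ... | no  x≢e  = max (x∈p∧x≢y⇒x∈p-y x∈X x≢e) x∉K

  maximal⇒largest : ∀ {X K J} → Indep K → Maximal X K → J ⊆ X → Indep J → ∣ J ∣ ≤ ∣ K ∣
  maximal⇒largest iK max J⊆X iJ = ≮⇒≥ λ ∣K∣<∣J∣ →
    let x , x∈J , x∉K , iKx = indep-aug iK iJ ∣K∣<∣J∣ in max (J⊆X x∈J) x∉K iKx

  RobustlySpanned : ℕ → Subset n → Fin n → Set
  RobustlySpanned m X e = ∀ F → ∣ F ∣ < m → ∃[ I ] I ⊆ X ─ F × Indep I × ¬ Indep (I ∪ ⁅ e ⁆)

  faultTolerant-rank+∣F∣≤∣B∣ : ∀ {k B F r} → IsMatroidRank M r → FaultTolerant M k B →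
                              F ⊆ B → ∣ F ∣ ≤ k → r + ∣ F ∣ ≤ ∣ B ∣
  faultTolerant-rank+∣F∣≤∣B∣ {B = B} {F} {r} rankM ft F⊆B ∣F∣≤k
    with (J , J⊆B─F , _ , ∣J∣≡r) , _ ← ft F F⊆B ∣F∣≤k r rankM = begin
      r + ∣ F ∣      ≡⟨ cong (_+ ∣ F ∣) (sym ∣J∣≡r) ⟩
      ∣ J ∣ + ∣ F ∣  ≤⟨ +-monoˡ-≤ ∣ F ∣ (p⊆q⇒∣p∣≤∣q∣ J⊆B─F) ⟩
      ∣ B ─ F ∣ + ∣ F ∣ ≡⟨ ∣p─q∣+∣q∣≡∣p∣ B F F⊆B ⟩
      ∣ B ∣          ∎
    where open ≤-Reasoning

  faultTolerant-lower : ∀ {k B r} → IsMatroidRank M r → 1 ≤ r → FaultTolerant M k B → r + k ≤ ∣ B ∣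
  faultTolerant-lower {k} {B} {r} rankM 1≤r ft with k ≤? ∣ B ∣
  ... | yes k≤∣B∣ with F , F⊆B , ∣F∣≡k ← ⊆-ofSize B k k≤∣B∣ =
    subst (λ m → r + m ≤ ∣ B ∣) ∣F∣≡k (faultTolerant-rank+∣F∣≤∣B∣ rankM ft F⊆B (≤-reflexive ∣F∣≡k))
  ... | no k≰∣B∣ = contradiction
    (faultTolerant-rank+∣F∣≤∣B∣ rankM ft ⊆-refl (<⇒≤ (≰⇒> k≰∣B∣)))
    (<⇒≱ (+-monoˡ-≤ ∣ B ∣ 1≤r))

  module _ (indep? : ∀ S → Dec (Indep S)) where

    extendToMaximal : ∀ fuel {X K} → K ⊆ X → Indep K → n ≤ fuel + ∣ K ∣ →
                      ∃[ K′ ] K ⊆ K′ × K′ ⊆ X × Indep K′ × Maximal X K′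
    extendToMaximal fuel {X} {K} K⊆X iK n≤fuel+∣K∣
      with any? (λ x → x ∈? X ×-dec ¬? (x ∈? K) ×-dec indep? (K ∪ ⁅ x ⁆))
    ... | no ∄x = K , ⊆-refl , K⊆X , iK , λ x∈X x∉K iKx → ∄x (_ , x∈X , x∉K , iKx)
    ... | yes (x , x∈X , x∉K , iKx) with fuel
    ...   | zero = contradiction (≤-trans (∣p∣≤n (K ∪ ⁅ x ⁆)) n≤fuel+∣K∣) (<⇒≱ (∣p∣<∣p∪⁅x⁆∣ x∉K))
    ...   | suc fuel =
      let K′ , K+x⊆K′ , rest = extendToMaximal fuel (∪-lub K⊆X (x∈p⇒⁅x⁆⊆p x∈X)) iKx n≤fuel+∣K+x∣
      in  K′ , ⊆-trans (p⊆p∪q ⁅ x ⁆) K+x⊆K′ , rest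
      where
      n≤fuel+∣K+x∣ : n ≤ fuel + ∣ K ∪ ⁅ x ⁆ ∣
      n≤fuel+∣K+x∣ = ≤-trans n≤fuel+∣K∣
        (≤-trans (≤-reflexive (sym (+-suc fuel ∣ K ∣))) (+-monoʳ-≤ fuel (∣p∣<∣p∪⁅x⁆∣ x∉K)))

    maximalExtension : ∀ {X K} → K ⊆ X → Indep K → ∃[ K′ ] K ⊆ K′ × K′ ⊆ X × Indep K′ × Maximal X K′
    maximalExtension K⊆X iK = extendToMaximal n K⊆X iK (m≤m+n n _)

    isRank-removeSpanned : ∀ {X I e r} → IsRank M X r → I ⊆ X - e → Indep I → ¬ Indep (I ∪ ⁅ e ⁆) →
                           IsRank M (X - e) r
    isRank-removeSpanned {X} {e = e} {r} ((J , J⊆X , iJ , ∣J∣≡r) , rank-≤) I⊆X-e iI dep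
      with K , I⊆K , K⊆X-e , iK , maxK ← maximalExtension I⊆X-e iI =
      (K , K⊆X-e , iK , ≤-antisym (rank-≤ K (⊆-trans K⊆X-e X-e⊆X) iK) r≤∣K∣) ,
      λ J′ J′⊆X-e → rank-≤ J′ (⊆-trans J′⊆X-e X-e⊆X)
      where
      X-e⊆X : X - e ⊆ X
      X-e⊆X = p─q⊆p X ⁅ e ⁆
      r≤∣K∣ : r ≤ ∣ K ∣
      r≤∣K∣ = subst (_≤ ∣ K ∣) ∣J∣≡r
        (maximal⇒largest iK (maximal-insertSpanned maxK (dependent-∪⁅⁆-mono I⊆K dep)) J⊆X iJ)

    faultTolerant-removeRobustlySpanned : ∀ {k B e} → FaultTolerant M k B → RobustlySpanned (suc k) B e →
                                          FaultTolerant M k (B - e)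
    faultTolerant-removeRobustlySpanned {B = B} {e} ft spanned F F⊆B-e ∣F∣≤k r rankM
      with I , I⊆B─F , iI , dep ← spanned F (s≤s ∣F∣≤k) =
      subst (λ A → IsRank M A r) (sym (p─q─r≡p─r─q B ⁅ e ⁆ F))
        (isRank-removeSpanned (ft F (⊆-trans F⊆B-e (p─q⊆p B ⁅ e ⁆)) ∣F∣≤k r rankM) I⊆B─F-e iI dep)
      where
      I⊆B─F-e : I ⊆ B ─ F - e
      I⊆B─F-e x∈I = x∈p∧x≢y⇒x∈p-y (I⊆B─F x∈I) λ { refl → dependent⇒∉ iI dep x∈I }

    robustSpanningSet : ∀ {r} → (∀ I → Indep I → ∣ I ∣ ≤ r) → ∀ m X →
      ∃[ G ] ∣ G ∣ ≤ m * r × (∀ {e} → e ∈ X → e ∉ G → RobustlySpanned m X e)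
    robustSpanningSet bound zero    X = ⊥ , ≤-reflexive (∣⊥∣≡0 n) , λ _ _ _ ()
    robustSpanningSet bound (suc m) X
      with I , _ , I⊆X , iI , maxI ← maximalExtension {X} ⊥⊆ indep-∅
      with G , ∣G∣≤mr , spannedG ← robustSpanningSet bound m (X ─ I) =
      I ∪ G , ≤-trans (∣p∪q∣≤∣p∣+∣q∣ I G) (+-mono-≤ (bound I iI) ∣G∣≤mr) ,
      λ e∈X e∉I∪G → spanned e∈X (e∉I∪G ∘ x∈p∪q⁺ ∘ inj₁) (e∉I∪G ∘ x∈p∪q⁺ ∘ inj₂)
      where
      spanned : ∀ {e} → e ∈ X → e ∉ I → e ∉ G → RobustlySpanned (suc m) X e
      spanned e∈X e∉I e∉G F ∣F∣<1+m with any? (λ x → x ∈? I ×-dec x ∈? F)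
      ... | no I∩F≡∅ = I , I⊆X─F , iI , maxI e∈X e∉I
        where
        I⊆X─F : I ⊆ X ─ F
        I⊆X─F x∈I = x∈p∧x∉q⇒x∈p─q (I⊆X x∈I) λ x∈F → I∩F≡∅ (_ , x∈I , x∈F)
      ... | yes (f , f∈I , f∈F)
        with J , J⊆ , iJ , dep ← spannedG (x∈p∧x∉q⇒x∈p─q e∈X e∉I) e∉G
                                          (F - f) (≤-trans (x∈p⇒∣p-x∣<∣p∣ f∈F) (≤-pred ∣F∣<1+m)) =
        J , ⊆-trans J⊆ (p─q─[r-x]⊆p─r f∈I) , iJ , dep

    ftBasis-upper : ∀ {k B r} → IsMatroidRank M r → IsFTBasis M k B → ∣ B ∣ ≤ suc k * r
    ftBasis-upper {k} {B} (_ , rank-≤) (ft , minimal)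
      with G , ∣G∣≤ , spanned ← robustSpanningSet (λ I → rank-≤ I ⊆⊤) (suc k) B
      with ⊆⊎∃∉ B G
    ... | inj₁ B⊆G = ≤-trans (p⊆q⇒∣p∣≤∣q∣ B⊆G) ∣G∣≤
    ... | inj₂ (e , e∈B , e∉G) = contradiction
      (minimal (B - e) (faultTolerant-removeRobustlySpanned ft (spanned e∈B e∉G)))
      (<⇒≱ (x∈p⇒∣p-x∣<∣p∣ e∈B))

proposition6 : ∀ {n : ℕ} (M : Matroid n) (r : ℕ) → IsMatroidRank M r → 1 ≤ r →
    ∀ (k : ℕ) (B : Subset n) → IsFTBasis M k B →
    (r + k ≤ ∣ B ∣) × (∣ B ∣ ≤ suc k * r)
-- Independence need not be decidable, but it is ¬¬-decidable on the finitely many subsets,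
-- which suffices because the upper bound is itself a decidable statement.
proposition6 M r rankM 1≤r k B basis =
  faultTolerant-lower M rankM 1≤r (proj₁ basis) ,
  decidable-stable (∣ B ∣ ≤? suc k * r) λ ∣B∣≰ →
    ¬¬-decidable (Matroid.Indep M) λ indep? → ∣B∣≰ (ftBasis-upper M indep? rankM basis)
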